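{- Let $S$ be a regular closed semi-Thue system over $\Sigma$ and let $\mathcal A$ be a finite state automaton representing the regular languages generated by $S$ and $\Sigma$. Then $\mathrm{DKm}(S)$ and $\mathrm{DKm}(\mathcal A)$ are equivalent, i.e. they prove the same set of formulae.
   Context: $\Sigma$: alphabet with involution $a\mapsto\bar a$; $\overline{a_1\cdots a_n}=\bar a_n\cdots\bar a_1$. A semi-Thue system $S$ is a set of rules $u\to v$ ($u,v\in\Sigma^*$); closed if $u\to v\in S\Rightarrow\bar u\to\bar v\in S$; context-free if all rules have form $a\to u$, $a\in\Sigma$; $L_a(S)=\{u\mid a\Rightarrow_S u\}$; $S$ is regular if it is context-free and every $L_a(S)$ is regular. "$\mathcal A$ represents the languages" means: $\mathcal A=(\Sigma,Q,I,F,\delta)$ is an FSA without silent transitions, each $a\in\Sigma$ has a unique initial state $init_a\in I$, and the automaton $\mathcal A$ with $init_a$ as sole initial state accepts exactly $L_a(S)$. Write $s\xrightarrow{a}_{\mathcal A}s'$ for $(s,a,s')\in\delta$. Formulae are in negation normal form. A nested sequent is a finite multiset of formulae, labelled formulae $s:A$ ($s\in Q$; only in $\mathrm{DKm}(\mathcal A)$) and structures $a\{\Delta\}$, viewed as a tree whose nodes carry multisets and whose edges are labelled in $\Sigma$. Contexts $\Gamma[\ ]$, $\Gamma[\ ]_i[\ ]_j$ have holes at nodes. $\mathcal R(\Gamma,i,j)$ is the automaton with the nodes as states, initial $i$, final $j$, transitions $x\xrightarrow{a}y$, $y\xrightarrow{\bar a}x$ for each edge $x\xrightarrow{a}y$.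 $\mathrm{DKm}$ rules (conclusion from premises): $\mathit{id}_d$: $\Gamma[p,\neg p]$; $\land_d$: $\Gamma[A\land B]$ from $\Gamma[A\land B,A]$, $\Gamma[A\land B,B]$; $\lor_d$: $\Gamma[A\lor B]$ from $\Gamma[A\lor B,A,B]$; $[a]_d$: $\Gamma[[a]A]$ from $\Gamma[[a]A,a\{A\}]$; $\langle a\rangle\!\uparrow$: $\Gamma[a\{\Delta\},\langle a\rangle A]$ from $\Gamma[a\{\Delta,A\},\langle a\rangle A]$; $\langle a\rangle\!\downarrow$: $\Gamma[a\{\Delta,\langle\bar a\rangle A\}]$ from $\Gamma[a\{\Delta,\langle\bar a\rangle A\},A]$. $\mathrm{DKm}(S)$ adds $p_S$: $\Gamma[\langle a\rangle A]_i[\emptyset]_j$ from $\Gamma[\langle a\rangle A]_i[A]_j$ provided $\mathcal R(\Gamma[\ ]_i[\ ]_j,i,j)\cap L_a(S)\neq\emptyset$. $\mathrm{DKm}(\mathcal A)$ adds instead: $i$: $\Gamma[\langle a\rangle A]$ from $\Gamma[\langle a\rangle A,init_a:A]$; $t\!\uparrow$: $\Gamma[s:A,a\{\Delta\}]$ from $\Gamma[s:A,a\{s':A,\Delta\}]$ if $s\xrightarrow{a}_{\mathcal A}s'$; $t\!\downarrow$: $\Gamma[a\{s:A,\Delta\}]$ from $\Gamma[a\{s:A,\Delta\},s':A]$ if $s\xrightarrow{\bar a}_{\mathcal A}s'$; $f$: $\Gamma[s:A]$ from $\Gamma[s:A,A]$ if $s\in F$. A formula is provable if the sequent consisting of it alone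 is derivable. -}

module Defs where

open import Data.Nat using (ℕ)
open import Data.Fin using (Fin)
open import Data.Bool using (Bool; true)
open import Data.Empty using (⊥)
open import Data.List using (List; []; _∷_; _++_; map; reverse)
open import Data.List.Membership.Propositional using (_∈_)
open import Data.List.Relation.Unary.Any using (here; there)
open import Data.Product using (Σ; ∃; _×_; _,_)
open import Relation.Binary.PropositionalEquality using (_≡_)
open import Relation.Binary.Construct.Closure.ReflexiveTransitive using (Star)

record Alph : Set where
  field
    size    : ℕ
    bar     : Fin size → Fin size
    bar-inv : ∀ a → bar (bar a) ≡ a

module _ (𝔄 : Alph) where
  open Alph 𝔄

  Letter : Set
  Letter = Fin size

  barW : List Letter → List Letter
  barW w = reverse (map bar w)

  Rules : Set₁
  Rules = List Letter → List Letter → Set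

  data Step (S : Rules) : List Letter → List Letter → Set where
    step : ∀ x u v y → S u v → Step S (x ++ u ++ y) (x ++ v ++ y)

  _⇒[_]_ : List Letter → Rules → List Letter → Set
  u ⇒[ S ] v = Star (Step S) u v

  LangS : Rules → Letter → List Letter → Set
  LangS S a u = (a ∷ []) ⇒[ S ] u

  Closed : Rules → Set
  Closed S = ∀ u v → S u v → S (barW u) (barW v)

  ContextFree : Rules → Set
  ContextFree S = ∀ u v → S u v → ∃ λ a → u ≡ a ∷ []

  record FSA : Set where
    field
      nQ      : ℕ
      δ       : Fin nQ → Letter → Fin nQ → Bool
      isInit  : Fin nQ → Bool
      isFinal : Fin nQ → Bool

  module _ (𝒜 : FSA) where
    open FSA 𝒜

    data AcceptsFrom : Fin nQ → List Letter → Set where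
      done : ∀ {q} → isFinal q ≡ true → AcceptsFrom q []
      move : ∀ {q a q' w} → δ q a q' ≡ true → AcceptsFrom q' w →
             AcceptsFrom q (a ∷ w)

    Accepts : List Letter → Set
    Accepts w = Σ (Fin nQ) λ q → isInit q ≡ true × AcceptsFrom q w

  IsRegularLang : (List Letter → Set) → Set
  IsRegularLang L = Σ FSA λ 𝒜 → ∀ w → (L w → Accepts 𝒜 w) × (Accepts 𝒜 w → L w)

  Regular : Rules → Set
  Regular S = ContextFree S × (∀ a → IsRegularLang (LangS S a))

  record Represents (S : Rules) (𝒜 : FSA) : Set where
    open FSA 𝒜
    field
      init    : Letter → Fin nQ
      init∈I  : ∀ a → isInit (init a) ≡ true
      correct : ∀ a w → (LangS S a w → AcceptsFrom 𝒜 (init a) w)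
                      × (AcceptsFrom 𝒜 (init a) w → LangS S a w)

  data Fm : Set where
    pos neg  : ℕ → Fm
    _∧_ _∨_  : Fm → Fm → Fm
    box dia  : Letter → Fm → Fm

  -- Nested sequents over a set Q of states (labels s : A).
  -- Multisets are represented by lists; all rules below only test
  -- membership and add elements, so order is immaterial.

  data Seq (Q : Set) : Set where
    ⟦_,_,_⟧ : List Fm → List (Q × Fm) → List (Letter × Seq Q) → Seq Q

  module _ {Q : Set} where

    fms : Seq Q → List Fm
    fms ⟦ fs , ls , ks ⟧ = fs

    labs : Seq Q → List (Q × Fm)
    labs ⟦ fs , ls , ks ⟧ = ls

    kids : Seq Q → List (Letter × Seq Q)
    kids ⟦ fs , ls , ks ⟧ = ks

    addF : Fm → Seq Q → Seq Q
    addF A ⟦ fs , ls , ks ⟧ = ⟦ A ∷ fs , ls , ks ⟧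

    addL : Q → Fm → Seq Q → Seq Q
    addL s A ⟦ fs , ls , ks ⟧ = ⟦ fs , (s , A) ∷ ls , ks ⟧

    addK : Letter → Seq Q → Seq Q → Seq Q
    addK a Δ ⟦ fs , ls , ks ⟧ = ⟦ fs , ls , (a , Δ) ∷ ks ⟧

    updAt : ∀ {X : Set} {x : X} (xs : List X) → x ∈ xs → X → List X
    updAt (_ ∷ xs) (here _)  y = y ∷ xs
    updAt (x ∷ xs) (there p) y = x ∷ updAt xs p y

    onKid : ∀ {a Δ} (Γ : Seq Q) → (a , Δ) ∈ kids Γ → (Seq Q → Seq Q) → Seq Q
    onKid {a} {Δ} ⟦ fs , ls , ks ⟧ m f = ⟦ fs , ls , updAt ks m (a , f Δ) ⟧

    data Pos : Seq Q → Set where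
      here : ∀ {Γ} → Pos Γ
      down : ∀ {fs ls ks a Δ} → (a , Δ) ∈ ks → Pos Δ → Pos ⟦ fs , ls , ks ⟧

    subAt : (Γ : Seq Q) → Pos Γ → Seq Q
    subAt Γ here = Γ
    subAt ⟦ fs , ls , ks ⟧ (down {Δ = Δ} m π) = subAt Δ π

    replace : (Γ : Seq Q) → Pos Γ → Seq Q → Seq Q
    replace Γ here t = t
    replace ⟦ fs , ls , ks ⟧ (down {a = a} {Δ = Δ} m π) t =
      ⟦ fs , ls , updAt ks m (a , replace Δ π t) ⟧

    ext : (Γ : Seq Q) (π : Pos Γ) → ∀ {a Δ} → (a , Δ) ∈ kids (subAt Γ π) → Pos Γ
    ext ⟦ fs , ls , ks ⟧ here m = down m here
    ext ⟦ fs , ls , ks ⟧ (down {Δ = Δ} m' π) m = down m' (ext Δ π m)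

    data Walk (Γ : Seq Q) : Pos Γ → List Letter → Pos Γ → Set where
      nil : ∀ {π} → Walk Γ π [] π
      dn  : ∀ {π a Δ w ρ} (m : (a , Δ) ∈ kids (subAt Γ π)) →
            Walk Γ (ext Γ π m) w ρ → Walk Γ π (a ∷ w) ρ
      up  : ∀ {π a Δ w ρ} (m : (a , Δ) ∈ kids (subAt Γ π)) →
            Walk Γ π w ρ → Walk Γ (ext Γ π m) (bar a ∷ w) ρ

    -- DKm rules, plus a family E of extra one-premise rules
    -- (E Γ Γ' : Γ is a conclusion with premise Γ')

    data Der (E : Seq Q → Seq Q → Set) : Seq Q → Set where
      idd  : ∀ {Γ} (π : Pos Γ) {p} →
             pos p ∈ fms (subAt Γ π) → neg p ∈ fms (subAt Γ π) → Der E Γ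
      ∧d   : ∀ {Γ} (π : Pos Γ) {A B} → (A ∧ B) ∈ fms (subAt Γ π) →
             Der E (replace Γ π (addF A (subAt Γ π))) →
             Der E (replace Γ π (addF B (subAt Γ π))) → Der E Γ
      ∨d   : ∀ {Γ} (π : Pos Γ) {A B} → (A ∨ B) ∈ fms (subAt Γ π) →
             Der E (replace Γ π (addF A (addF B (subAt Γ π)))) → Der E Γ
      boxd : ∀ {Γ} (π : Pos Γ) {a A} → box a A ∈ fms (subAt Γ π) →
             Der E (replace Γ π (addK a ⟦ A ∷ [] , [] , [] ⟧ (subAt Γ π))) →
             Der E Γ
      dia↑ : ∀ {Γ} (π : Pos Γ) {a A Δ} → dia a A ∈ fms (subAt Γ π) →
             (m : (a , Δ) ∈ kids (subAt Γ π)) →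
             Der E (replace Γ π (onKid (subAt Γ π) m (addF A))) → Der E Γ
      dia↓ : ∀ {Γ} (π : Pos Γ) {a A Δ} →
             (m : (a , Δ) ∈ kids (subAt Γ π)) → dia (bar a) A ∈ fms Δ →
             Der E (replace Γ π (addF A (subAt Γ π))) → Der E Γ
      extra : ∀ {Γ Γ'} → E Γ Γ' → Der E Γ' → Der E Γ

  -- DKm(S): the propagation rule p_S (no labelled formulae: Q = ⊥)

  data RuleS (S : Rules) : Seq ⊥ → Seq ⊥ → Set where
    pS : ∀ {Γ} (i j : Pos Γ) {a A} → dia a A ∈ fms (subAt Γ i) →
         (w : List Letter) → Walk Γ i w j → LangS S a w →
         RuleS S Γ (replace Γ j (addF A (subAt Γ j)))

  ProvableS : Rules → Fm → Set
  ProvableS S A = Der (RuleS S) ⟦ A ∷ [] , [] , [] ⟧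

  module _ (𝒜 : FSA) (init : Letter → Fin (FSA.nQ 𝒜)) where
    open FSA 𝒜

    data RuleA : Seq (Fin nQ) → Seq (Fin nQ) → Set where
      iR  : ∀ {Γ} (π : Pos Γ) {a A} → dia a A ∈ fms (subAt Γ π) →
            RuleA Γ (replace Γ π (addL (init a) A (subAt Γ π)))
      t↑  : ∀ {Γ} (π : Pos Γ) {s s' a A Δ} → (s , A) ∈ labs (subAt Γ π) →
            (m : (a , Δ) ∈ kids (subAt Γ π)) → δ s a s' ≡ true →
            RuleA Γ (replace Γ π (onKid (subAt Γ π) m (addL s' A)))
      t↓  : ∀ {Γ} (π : Pos Γ) {s s' a A Δ} →
            (m : (a , Δ) ∈ kids (subAt Γ π)) → (s , A) ∈ labs Δ →
            δ s (bar a) s' ≡ true →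
            RuleA Γ (replace Γ π (addL s' A (subAt Γ π)))
      fR  : ∀ {Γ} (π : Pos Γ) {s A} → (s , A) ∈ labs (subAt Γ π) →
            isFinal s ≡ true →
            RuleA Γ (replace Γ π (addF A (subAt Γ π)))

    ProvableA : Fm → Set
    ProvableA A = Der RuleA ⟦ A ∷ [] , [] , [] ⟧

module Submission where

-- Both calculi share the logical rules, so derivations are translated rule by rule between
-- sequents with the same skeleton, i.e. equal up to labelled formulae. An instance of p_S for
-- ⟨a⟩A at i whose walk to j reads u ∈ L_a(S) becomes rule i at i, one t↑ or t↓ per edge of the
-- walk along an accepting run of 𝒜 from init a on u, and f at j. Conversely, every label s : B
-- of a DKm(𝒜)-sequent is justified by some ⟨a⟩B and a walk to its node on which 𝒜 runs from
-- init a to s; when f fires on a final s that walk reads a word of L_a(S), so p_S applies.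
-- Logical rules only grow a sequent and add no labels, which keeps this invariant.

open import Defs
open import Data.Nat using (ℕ; suc; _<_)
open import Data.Nat.Properties using (<-irrefl; ≤-refl; m<n⇒m<1+n)
open import Data.Fin using (Fin)
open import Data.Bool using (true)
open import Data.Empty using (⊥; ⊥-elim)
open import Data.Unit using (⊤; tt)
open import Data.List using (List; []; _∷_; _++_; _∷ʳ_; length)
open import Data.List.Properties using (++-identityʳ; ∷-injectiveˡ; ∷-injectiveʳ)
open import Data.List.Membership.Propositional using (_∈_)
open import Data.List.Relation.Binary.Subset.Propositional using (_⊆_)
open import Data.List.Relation.Unary.Any using (here; there)
open import Data.Product using (Σ; _×_; _,_; proj₁; proj₂)
open import Data.Sum using (_⊎_; inj₁; inj₂)
open import Relation.Binary.PropositionalEquality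

private variable
  X Q Q₁ Q₂ Q₃ : Set

-- New children are put in front of a node (addK), so list positions are counted
-- from the end: that way they survive every rule of the calculus.
indexʳ : {x : X} {xs : List X} → x ∈ xs → ℕ
indexʳ {xs = _ ∷ ys} (here _) = length ys
indexʳ (there m)              = indexʳ m

data Lookupʳ {X : Set} : List X → ℕ → X → Set where
  now   : ∀ {x xs} → Lookupʳ (x ∷ xs) (length xs) x
  later : ∀ {y xs n x} → Lookupʳ xs n x → Lookupʳ (y ∷ xs) n x

Lookupʳ⇒<length : ∀ {xs n} {x : X} → Lookupʳ xs n x → n < length xs
Lookupʳ⇒<length now       = ≤-refl
Lookupʳ⇒<length (later l) = m<n⇒m<1+n (Lookupʳ⇒<length l)

Lookupʳ-functional : ∀ {xs n} {x y : X} → Lookupʳ xs n x → Lookupʳ xs n y → x ≡ y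
Lookupʳ-functional now       now        = refl
Lookupʳ-functional now       (later l)  = ⊥-elim (<-irrefl refl (Lookupʳ⇒<length l))
Lookupʳ-functional (later l) now        = ⊥-elim (<-irrefl refl (Lookupʳ⇒<length l))
Lookupʳ-functional (later l) (later l') = Lookupʳ-functional l l'

∈⇒Lookupʳ : ∀ {xs} {x : X} (m : x ∈ xs) → Lookupʳ xs (indexʳ m) x
∈⇒Lookupʳ (here refl) = now
∈⇒Lookupʳ (there m)   = later (∈⇒Lookupʳ m)

Lookupʳ⇒∈ : ∀ {xs n} {x : X} → Lookupʳ xs n x → Σ (x ∈ xs) λ m → indexʳ m ≡ n
Lookupʳ⇒∈ now = here refl , refl
Lookupʳ⇒∈ (later l) with Lookupʳ⇒∈ l
... | m , e = there m , e

module _ (𝔄 : Alph) where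
  open Alph 𝔄 using (bar)

  Children : Set → Set
  Children Q = List (Letter 𝔄 × Seq 𝔄 Q)

  -- updAt has an implicit Q that does not occur in its type, hence the explicit {Q = Q} below.
  length-updAt : ∀ {xs} {x y : X} (m : x ∈ xs) → length (updAt 𝔄 {Q} xs m y) ≡ length xs
  length-updAt (here refl)       = refl
  length-updAt {Q = Q} (there m) = cong suc (length-updAt {Q = Q} m)

  Lookupʳ-updAt : ∀ {xs} {x y : X} (m : x ∈ xs) → Lookupʳ (updAt 𝔄 {Q} xs m y) (indexʳ m) y
  Lookupʳ-updAt (here refl)       = now
  Lookupʳ-updAt {Q = Q} (there m) = later (Lookupʳ-updAt {Q = Q} m)

  Lookupʳ-updAt⁻ : ∀ {xs} {x y z : X} (m : x ∈ xs) {n} → Lookupʳ (updAt 𝔄 {Q} xs m y) n z →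
                   (n ≡ indexʳ m × z ≡ y) ⊎ Lookupʳ xs n z
  Lookupʳ-updAt⁻ (here refl) now       = inj₁ (refl , refl)
  Lookupʳ-updAt⁻ (here refl) (later l) = inj₂ (later l)
  Lookupʳ-updAt⁻ {Q = Q} {xs = x ∷ xs} (there m) now =
    inj₂ (subst (λ n → Lookupʳ (x ∷ xs) n x) (sym (length-updAt {Q = Q} m)) now)
  Lookupʳ-updAt⁻ {Q = Q} (there m) (later l) with Lookupʳ-updAt⁻ {Q = Q} m l
  ... | inj₁ e  = inj₁ e
  ... | inj₂ l' = inj₂ (later l')

  address : {Γ : Seq 𝔄 Q} → Pos 𝔄 Γ → List ℕ
  address here       = []
  address (down m π) = indexʳ m ∷ address π

  data SubAt {Q : Set} : Seq 𝔄 Q → List ℕ → Seq 𝔄 Q → Set where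
    root  : ∀ {Γ} → SubAt Γ [] Γ
    child : ∀ {fs ls ks n a Δ p Y} → Lookupʳ ks n (a , Δ) → SubAt Δ p Y →
            SubAt ⟦ fs , ls , ks ⟧ (n ∷ p) Y

  SubAt-address : {Γ : Seq 𝔄 Q} (π : Pos 𝔄 Γ) → SubAt Γ (address π) (subAt 𝔄 Γ π)
  SubAt-address here       = root
  SubAt-address (down m π) = child (∈⇒Lookupʳ m) (SubAt-address π)

  SubAt⇒Pos : {Γ Y : Seq 𝔄 Q} {p : List ℕ} → SubAt Γ p Y →
              Σ (Pos 𝔄 Γ) λ π → address π ≡ p × subAt 𝔄 Γ π ≡ Y
  SubAt⇒Pos root = here , refl , refl
  SubAt⇒Pos (child l s) with Lookupʳ⇒∈ l | SubAt⇒Pos s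
  ... | m , e | π , e' , e'' = down m π , cong₂ _∷_ e e' , e''

  SubAt-functional : {Γ Y Z : Seq 𝔄 Q} {p : List ℕ} → SubAt Γ p Y → SubAt Γ p Z → Y ≡ Z
  SubAt-functional root        root          = refl
  SubAt-functional (child l s) (child l' s') with Lookupʳ-functional l l'
  ... | refl = SubAt-functional s s'

  SubAt-++ : {Γ Y Z : Seq 𝔄 Q} {p r : List ℕ} → SubAt Γ p Y → SubAt Y r Z → SubAt Γ (p ++ r) Z
  SubAt-++ root        t = t
  SubAt-++ (child l s) t = child l (SubAt-++ s t)

  SubAt-∷ʳ : {Γ Y Z : Seq 𝔄 Q} {p : List ℕ} {n : ℕ} {a : Letter 𝔄} → SubAt Γ p Y →
             Lookupʳ (kids 𝔄 Y) n (a , Z) → SubAt Γ (p ∷ʳ n) Z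
  SubAt-∷ʳ {Y = ⟦ _ , _ , _ ⟧} s l = SubAt-++ s (child l root)

  SubAt-replace : {Γ : Seq 𝔄 Q} (π : Pos 𝔄 Γ) {t : Seq 𝔄 Q} → SubAt (replace 𝔄 Γ π t) (address π) t
  SubAt-replace here                 = root
  SubAt-replace {Q = Q} (down m π) = child (Lookupʳ-updAt {Q = Q} m) (SubAt-replace π)

  SubAt-onKid : {Δ Y : Seq 𝔄 Q} {a : Letter 𝔄} (m : (a , Y) ∈ kids 𝔄 Δ) {f : Seq 𝔄 Q → Seq 𝔄 Q} →
                SubAt (onKid 𝔄 Δ m f) (indexʳ m ∷ []) (f Y)
  SubAt-onKid {Q = Q} {Δ = ⟦ _ , _ , _ ⟧} m = child (Lookupʳ-updAt {Q = Q} m) root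

  address-ext : {Γ : Seq 𝔄 Q} (π : Pos 𝔄 Γ) {a : Letter 𝔄} {Δ : Seq 𝔄 Q}
                (m : (a , Δ) ∈ kids 𝔄 (subAt 𝔄 Γ π)) →
                address (ext 𝔄 Γ π m) ≡ address π ∷ʳ indexʳ m
  address-ext {Γ = ⟦ _ , _ , _ ⟧} here m = refl
  address-ext (down m' π) m = cong (indexʳ m' ∷_) (address-ext π m)

  address-∷ʳ⁻ : {Γ : Seq 𝔄 Q} (π : Pos 𝔄 Γ) (p : List ℕ) (n : ℕ) → address π ≡ p ∷ʳ n →
                Σ (Pos 𝔄 Γ) λ π₀ → Σ (Letter 𝔄) λ a → Σ (Seq 𝔄 Q) λ Y →
                Σ ((a , Y) ∈ kids 𝔄 (subAt 𝔄 Γ π₀)) λ m →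
                π ≡ ext 𝔄 Γ π₀ m × address π₀ ≡ p × indexʳ m ≡ n
  address-∷ʳ⁻ here       []      n ()
  address-∷ʳ⁻ here       (_ ∷ _) n ()
  address-∷ʳ⁻ (down m here) [] n refl = here , _ , _ , m , refl , refl , refl
  address-∷ʳ⁻ (down m (down _ _)) [] n ()
  address-∷ʳ⁻ (down m σ) (k ∷ p) n e with address-∷ʳ⁻ σ p n (∷-injectiveʳ e)
  ... | π₀ , a , Y , m' , refl , refl , e' =
    down m π₀ , a , Y , m' , refl , cong (_∷ p) (∷-injectiveˡ e) , e'

  data AddrWalk {Q : Set} (Γ : Seq 𝔄 Q) : List ℕ → List (Letter 𝔄) → List ℕ → Set where
    stay    : ∀ {p} → AddrWalk Γ p [] p
    descend : ∀ {p X n a Y w q} → SubAt Γ p X → Lookupʳ (kids 𝔄 X) n (a , Y) →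
              AddrWalk Γ (p ∷ʳ n) w q → AddrWalk Γ p (a ∷ w) q
    ascend  : ∀ {p X n a Y w q} → SubAt Γ p X → Lookupʳ (kids 𝔄 X) n (a , Y) →
              AddrWalk Γ p w q → AddrWalk Γ (p ∷ʳ n) (bar a ∷ w) q

  Walk⇒AddrWalk : {Γ : Seq 𝔄 Q} {π ρ : Pos 𝔄 Γ} {w : List (Letter 𝔄)} →
                  Walk 𝔄 Γ π w ρ → AddrWalk Γ (address π) w (address ρ)
  Walk⇒AddrWalk nil = stay
  Walk⇒AddrWalk {Γ = Γ} {π = π} (dn m r) =
    descend (SubAt-address π) (∈⇒Lookupʳ m)
            (subst (λ p → AddrWalk Γ p _ _) (address-ext π m) (Walk⇒AddrWalk r))
  Walk⇒AddrWalk {Γ = Γ} (up {π = π} m r) =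
    subst (λ p → AddrWalk Γ p _ _) (sym (address-ext π m))
          (ascend (SubAt-address π) (∈⇒Lookupʳ m) (Walk⇒AddrWalk r))

  AddrWalk⇒Walk : {Γ : Seq 𝔄 Q} {p q : List ℕ} {w : List (Letter 𝔄)} → AddrWalk Γ p w q →
                  (π : Pos 𝔄 Γ) → address π ≡ p → Σ (Pos 𝔄 Γ) λ ρ → address ρ ≡ q × Walk 𝔄 Γ π w ρ
  AddrWalk⇒Walk stay π e = π , e , nil
  AddrWalk⇒Walk {Γ = Γ} (descend s l r) π refl with SubAt-functional s (SubAt-address π)
  ... | refl with Lookupʳ⇒∈ l
  ... | m , refl with AddrWalk⇒Walk r (ext 𝔄 Γ π m) (address-ext π m)
  ... | ρ , e , w = ρ , e , dn m w
  AddrWalk⇒Walk (ascend {p = p} {n = n} s l r) π e with address-∷ʳ⁻ π p n e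
  ... | π₀ , _ , _ , m , refl , refl , refl with SubAt-functional s (SubAt-address π₀)
  ... | refl with Lookupʳ-functional l (∈⇒Lookupʳ m)
  ... | refl with AddrWalk⇒Walk r π₀ refl
  ... | ρ , e' , w = ρ , e' , up m w

  infix 4 _≅_ _≅*_
  data _≅_ {Q₁ Q₂ : Set} : Seq 𝔄 Q₁ → Seq 𝔄 Q₂ → Set
  data _≅*_ {Q₁ Q₂ : Set} : Children Q₁ → Children Q₂ → Set
  data _≅_ where
    node : ∀ {fs ls₁ ls₂ ks₁ ks₂} → ks₁ ≅* ks₂ → ⟦ fs , ls₁ , ks₁ ⟧ ≅ ⟦ fs , ls₂ , ks₂ ⟧
  data _≅*_ where
    []  : [] ≅* []
    _∷_ : ∀ {a Δ₁ Δ₂ ks₁ ks₂} → Δ₁ ≅ Δ₂ → ks₁ ≅* ks₂ → (a , Δ₁) ∷ ks₁ ≅* (a , Δ₂) ∷ ks₂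

  ≅-refl : {Γ : Seq 𝔄 Q} → Γ ≅ Γ
  ≅*-refl : {ks : Children Q} → ks ≅* ks
  ≅-refl {Γ = ⟦ _ , _ , _ ⟧} = node ≅*-refl
  ≅*-refl {ks = []}    = []
  ≅*-refl {ks = _ ∷ _} = ≅-refl ∷ ≅*-refl

  ≅-sym : {Γ₁ : Seq 𝔄 Q₁} {Γ₂ : Seq 𝔄 Q₂} → Γ₁ ≅ Γ₂ → Γ₂ ≅ Γ₁
  ≅*-sym : {ks₁ : Children Q₁} {ks₂ : Children Q₂} → ks₁ ≅* ks₂ → ks₂ ≅* ks₁
  ≅-sym (node k) = node (≅*-sym k)
  ≅*-sym []      = []
  ≅*-sym (s ∷ k) = ≅-sym s ∷ ≅*-sym k

  ≅-trans : {Γ₁ : Seq 𝔄 Q₁} {Γ₂ : Seq 𝔄 Q₂} {Γ₃ : Seq 𝔄 Q₃} → Γ₁ ≅ Γ₂ → Γ₂ ≅ Γ₃ → Γ₁ ≅ Γ₃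
  ≅*-trans : {ks₁ : Children Q₁} {ks₂ : Children Q₂}
             {ks₃ : Children Q₃} → ks₁ ≅* ks₂ → ks₂ ≅* ks₃ → ks₁ ≅* ks₃
  ≅-trans (node k) (node k') = node (≅*-trans k k')
  ≅*-trans []      []        = []
  ≅*-trans (s ∷ k) (s' ∷ k') = ≅-trans s s' ∷ ≅*-trans k k'

  ≅-∈fms : {X₁ : Seq 𝔄 Q₁} {X₂ : Seq 𝔄 Q₂} {A : Fm 𝔄} → X₁ ≅ X₂ → A ∈ fms 𝔄 X₁ → A ∈ fms 𝔄 X₂
  ≅-∈fms (node _) m = m

  ≅-kids : {X₁ : Seq 𝔄 Q₁} {X₂ : Seq 𝔄 Q₂} → X₁ ≅ X₂ → kids 𝔄 X₁ ≅* kids 𝔄 X₂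
  ≅-kids (node k) = k

  ≅*-length : {ks₁ : Children Q₁} {ks₂ : Children Q₂} →
              ks₁ ≅* ks₂ → length ks₁ ≡ length ks₂
  ≅*-length []      = refl
  ≅*-length (_ ∷ k) = cong suc (≅*-length k)

  ≅*-Lookupʳ : {ks₁ : Children Q₁} {ks₂ : Children Q₂} {n : ℕ} {a : Letter 𝔄}
               {Y₁ : Seq 𝔄 Q₁} → ks₁ ≅* ks₂ → Lookupʳ ks₁ n (a , Y₁) →
               Σ (Seq 𝔄 Q₂) λ Y₂ → Lookupʳ ks₂ n (a , Y₂) × Y₁ ≅ Y₂
  ≅*-Lookupʳ {ks₂ = (a , Y₂) ∷ ks₂} (s ∷ k) now =
    Y₂ , subst (λ n → Lookupʳ ((a , Y₂) ∷ ks₂) n (a , Y₂)) (sym (≅*-length k)) now , s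
  ≅*-Lookupʳ (_ ∷ k) (later l) with ≅*-Lookupʳ k l
  ... | Y₂ , l' , s = Y₂ , later l' , s

  ≅*-∈ : {ks₁ : Children Q₁} {ks₂ : Children Q₂} {a : Letter 𝔄}
         {Y₁ : Seq 𝔄 Q₁} → ks₁ ≅* ks₂ → (m : (a , Y₁) ∈ ks₁) →
         Σ (Seq 𝔄 Q₂) λ Y₂ → Σ ((a , Y₂) ∈ ks₂) λ m₂ → indexʳ m₂ ≡ indexʳ m × Y₁ ≅ Y₂
  ≅*-∈ (s ∷ k) (here refl) = _ , here refl , sym (≅*-length k) , s
  ≅*-∈ (_ ∷ k) (there m) with ≅*-∈ k m
  ... | Y₂ , m₂ , e , s = Y₂ , there m₂ , e , s

  ≅-SubAt : {Γ₁ X₁ : Seq 𝔄 Q₁} {Γ₂ : Seq 𝔄 Q₂} {p : List ℕ} → Γ₁ ≅ Γ₂ → SubAt Γ₁ p X₁ →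
            Σ (Seq 𝔄 Q₂) λ X₂ → SubAt Γ₂ p X₂ × X₁ ≅ X₂
  ≅-SubAt R root = _ , root , R
  ≅-SubAt (node k) (child l s) with ≅*-Lookupʳ k l
  ... | _ , l' , R with ≅-SubAt R s
  ... | X₂ , s' , R' = X₂ , child l' s' , R'

  ≅-subAt : {Γ₁ : Seq 𝔄 Q₁} {Γ₂ : Seq 𝔄 Q₂} → Γ₁ ≅ Γ₂ → (π₁ : Pos 𝔄 Γ₁) (π₂ : Pos 𝔄 Γ₂) →
            address π₁ ≡ address π₂ → subAt 𝔄 Γ₁ π₁ ≅ subAt 𝔄 Γ₂ π₂
  ≅-subAt R π₁ π₂ e with ≅-SubAt R (SubAt-address π₁)
  ... | _ , s , R' with SubAt-functional s (subst (λ p → SubAt _ p _) (sym e) (SubAt-address π₂))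
  ... | refl = R'

  transport : {Γ₁ : Seq 𝔄 Q₁} {Γ₂ : Seq 𝔄 Q₂} → Γ₁ ≅ Γ₂ → Pos 𝔄 Γ₁ → Pos 𝔄 Γ₂
  transport _ here = here
  transport (node k) (down m π) with ≅*-∈ k m
  ... | _ , m₂ , _ , R = down m₂ (transport R π)

  address-transport : {Γ₁ : Seq 𝔄 Q₁} {Γ₂ : Seq 𝔄 Q₂} (R : Γ₁ ≅ Γ₂) (π : Pos 𝔄 Γ₁) →
                      address π ≡ address (transport R π)
  address-transport _ here = refl
  address-transport (node k) (down m π) with ≅*-∈ k m
  ... | _ , m₂ , e , R = cong₂ _∷_ (sym e) (address-transport R π)

  ≅*-updAt : {ks₁ : Children Q₁} {ks₂ : Children Q₂} {a₁ a₂ : Letter 𝔄}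
             {Y₁ y₁ : Seq 𝔄 Q₁} {Y₂ y₂ : Seq 𝔄 Q₂} → ks₁ ≅* ks₂ →
             (m₁ : (a₁ , Y₁) ∈ ks₁) (m₂ : (a₂ , Y₂) ∈ ks₂) → indexʳ m₁ ≡ indexʳ m₂ →
             (Y₁ ≅ Y₂ → y₁ ≅ y₂) →
             updAt 𝔄 {Q₁} ks₁ m₁ (a₁ , y₁) ≅* updAt 𝔄 {Q₂} ks₂ m₂ (a₂ , y₂)
  ≅*-updAt (s ∷ k) (here refl) (here refl) _ f = f s ∷ k
  ≅*-updAt (_ ∷ k) (here refl) (there m₂)  e _ =
    ⊥-elim (<-irrefl (trans (sym e) (≅*-length k)) (Lookupʳ⇒<length (∈⇒Lookupʳ m₂)))
  ≅*-updAt (_ ∷ k) (there m₁)  (here refl) e _ =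
    ⊥-elim (<-irrefl (trans e (sym (≅*-length k))) (Lookupʳ⇒<length (∈⇒Lookupʳ m₁)))
  ≅*-updAt {Q₁ = Q₁} {Q₂ = Q₂} (s ∷ k) (there m₁) (there m₂) e f =
    s ∷ ≅*-updAt {Q₁ = Q₁} {Q₂ = Q₂} k m₁ m₂ e f

  ≅-replace : {Γ₁ t₁ : Seq 𝔄 Q₁} {Γ₂ t₂ : Seq 𝔄 Q₂} → Γ₁ ≅ Γ₂ → (π₁ : Pos 𝔄 Γ₁) (π₂ : Pos 𝔄 Γ₂) →
              address π₁ ≡ address π₂ → t₁ ≅ t₂ → replace 𝔄 Γ₁ π₁ t₁ ≅ replace 𝔄 Γ₂ π₂ t₂
  ≅-replace _ here       here       _  T = T
  ≅-replace {Q₁ = Q₁} {Q₂ = Q₂} (node k) (down m₁ π₁) (down m₂ π₂) e T =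
    node (≅*-updAt {Q₁ = Q₁} {Q₂ = Q₂} k m₁ m₂ (∷-injectiveˡ e)
                   λ R → ≅-replace R π₁ π₂ (∷-injectiveʳ e) T)

  ≅-subAt-transport : {Γ₁ : Seq 𝔄 Q₁} {Γ₂ : Seq 𝔄 Q₂} (R : Γ₁ ≅ Γ₂) (π : Pos 𝔄 Γ₁) →
                      subAt 𝔄 Γ₁ π ≅ subAt 𝔄 Γ₂ (transport R π)
  ≅-subAt-transport R π = ≅-subAt R π (transport R π) (address-transport R π)

  ≅-replace-transport : {Γ₁ t₁ : Seq 𝔄 Q₁} {Γ₂ t₂ : Seq 𝔄 Q₂} (R : Γ₁ ≅ Γ₂) (π : Pos 𝔄 Γ₁) →
                        t₁ ≅ t₂ → replace 𝔄 Γ₁ π t₁ ≅ replace 𝔄 Γ₂ (transport R π) t₂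
  ≅-replace-transport R π = ≅-replace R π (transport R π) (address-transport R π)

  ≅-addF : {X₁ : Seq 𝔄 Q₁} {X₂ : Seq 𝔄 Q₂} {A : Fm 𝔄} → X₁ ≅ X₂ → addF 𝔄 A X₁ ≅ addF 𝔄 A X₂
  ≅-addF (node k) = node k

  ≅-addL : {X : Seq 𝔄 Q} {s : Q} {A : Fm 𝔄} → X ≅ addL 𝔄 s A X
  ≅-addL {X = ⟦ _ , _ , _ ⟧} = node ≅*-refl

  ≅-addK : {X₁ Y₁ : Seq 𝔄 Q₁} {X₂ Y₂ : Seq 𝔄 Q₂} {a : Letter 𝔄} → X₁ ≅ X₂ → Y₁ ≅ Y₂ →
           addK 𝔄 a Y₁ X₁ ≅ addK 𝔄 a Y₂ X₂
  ≅-addK (node k) R = node (R ∷ k)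

  ≅-onKid : {X₁ Y₁ : Seq 𝔄 Q₁} {X₂ Y₂ : Seq 𝔄 Q₂} {a₁ a₂ : Letter 𝔄} → X₁ ≅ X₂ →
            (m₁ : (a₁ , Y₁) ∈ kids 𝔄 X₁) (m₂ : (a₂ , Y₂) ∈ kids 𝔄 X₂) → indexʳ m₁ ≡ indexʳ m₂ →
            (f : Seq 𝔄 Q₁ → Seq 𝔄 Q₁) (g : Seq 𝔄 Q₂ → Seq 𝔄 Q₂) → (Y₁ ≅ Y₂ → f Y₁ ≅ g Y₂) →
            onKid 𝔄 X₁ m₁ f ≅ onKid 𝔄 X₂ m₂ g
  ≅-onKid {Q₁ = Q₁} {Q₂ = Q₂} (node k) m₁ m₂ e _ _ h = node (≅*-updAt {Q₁ = Q₁} {Q₂ = Q₂} k m₁ m₂ e h)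

  ≅-AddrWalk : {Γ₁ : Seq 𝔄 Q₁} {Γ₂ : Seq 𝔄 Q₂} {p q : List ℕ} {w : List (Letter 𝔄)} →
               Γ₁ ≅ Γ₂ → AddrWalk Γ₁ p w q → AddrWalk Γ₂ p w q
  ≅-AddrWalk _ stay = stay
  ≅-AddrWalk R (descend s l r) with ≅-SubAt R s
  ... | _ , s' , R' with ≅*-Lookupʳ (≅-kids R') l
  ... | _ , l' , _ = descend s' l' (≅-AddrWalk R r)
  ≅-AddrWalk R (ascend s l r) with ≅-SubAt R s
  ... | _ , s' , R' with ≅*-Lookupʳ (≅-kids R') l
  ... | _ , l' , _ = ascend s' l' (≅-AddrWalk R r)

  ≅*-updAtʳ : {ks : Children Q} {a : Letter 𝔄} {Y y : Seq 𝔄 Q} (m : (a , Y) ∈ ks) →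
              Y ≅ y → ks ≅* updAt 𝔄 {Q} ks m (a , y)
  ≅*-updAtʳ (here refl) R = R ∷ ≅*-refl
  ≅*-updAtʳ {Q = Q} (there m) R = ≅-refl ∷ ≅*-updAtʳ {Q = Q} m R

  ≅-replaceʳ : {Γ t : Seq 𝔄 Q} (π : Pos 𝔄 Γ) → subAt 𝔄 Γ π ≅ t → Γ ≅ replace 𝔄 Γ π t
  ≅-replaceʳ here R = R
  ≅-replaceʳ {Q = Q} {Γ = ⟦ _ , _ , _ ⟧} (down m π) R = node (≅*-updAtʳ {Q = Q} m (≅-replaceʳ π R))

  ≅-onKidʳ : {X Y : Seq 𝔄 Q} {a : Letter 𝔄} (m : (a , Y) ∈ kids 𝔄 X) (f : Seq 𝔄 Q → Seq 𝔄 Q) →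
             Y ≅ f Y → X ≅ onKid 𝔄 X m f
  ≅-onKidʳ {Q = Q} {X = ⟦ _ , _ , _ ⟧} m _ R = node (≅*-updAtʳ {Q = Q} m R)

  infix 4 _⊑_ _⊑*_ _⊑ᵏ_
  data _⊑_ {Q : Set} : Seq 𝔄 Q → Seq 𝔄 Q → Set
  data _⊑*_ {Q : Set} : Children Q → Children Q → Set
  data _⊑ᵏ_ {Q : Set} : Children Q → Children Q → Set
  data _⊑_ where
    node : ∀ {fs fs' ls ls' ks ks'} → fs ⊆ fs' → ks ⊑ᵏ ks' → ⟦ fs , ls , ks ⟧ ⊑ ⟦ fs' , ls' , ks' ⟧
  data _⊑*_ where
    []  : [] ⊑* []
    _∷_ : ∀ {a Δ Δ' ks ks'} → Δ ⊑ Δ' → ks ⊑* ks' → (a , Δ) ∷ ks ⊑* (a , Δ') ∷ ks'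
  data _⊑ᵏ_ where
    pointwise : ∀ {ks ks'} → ks ⊑* ks' → ks ⊑ᵏ ks'
    new       : ∀ {ks ks' k} → ks ⊑ᵏ ks' → ks ⊑ᵏ k ∷ ks'

  ⊑-fms : {X X' : Seq 𝔄 Q} → X ⊑ X' → fms 𝔄 X ⊆ fms 𝔄 X'
  ⊑-fms (node f _) = f

  ⊑-kids : {X X' : Seq 𝔄 Q} → X ⊑ X' → kids 𝔄 X ⊑ᵏ kids 𝔄 X'
  ⊑-kids (node _ k) = k

  ⊑-refl : {Γ : Seq 𝔄 Q} → Γ ⊑ Γ
  ⊑*-refl : {ks : Children Q} → ks ⊑* ks
  ⊑-refl {Γ = ⟦ _ , _ , _ ⟧} = node (λ x → x) (pointwise ⊑*-refl)
  ⊑*-refl {ks = []}    = []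
  ⊑*-refl {ks = _ ∷ _} = ⊑-refl ∷ ⊑*-refl

  ⊑*-length : {ks ks' : Children Q} → ks ⊑* ks' → length ks ≡ length ks'
  ⊑*-length []      = refl
  ⊑*-length (_ ∷ k) = cong suc (⊑*-length k)

  ⊑*-Lookupʳ : {ks ks' : Children Q} {n : ℕ} {a : Letter 𝔄} {Y : Seq 𝔄 Q} →
               ks ⊑* ks' → Lookupʳ ks n (a , Y) → Σ (Seq 𝔄 Q) λ Y' → Lookupʳ ks' n (a , Y') × Y ⊑ Y'
  ⊑*-Lookupʳ {ks' = (a , Y') ∷ ks'} (g ∷ k) now =
    Y' , subst (λ n → Lookupʳ ((a , Y') ∷ ks') n (a , Y')) (sym (⊑*-length k)) now , g
  ⊑*-Lookupʳ (_ ∷ k) (later l) with ⊑*-Lookupʳ k l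
  ... | Y' , l' , g = Y' , later l' , g

  ⊑ᵏ-Lookupʳ : {ks ks' : Children Q} {n : ℕ} {a : Letter 𝔄} {Y : Seq 𝔄 Q} →
               ks ⊑ᵏ ks' → Lookupʳ ks n (a , Y) → Σ (Seq 𝔄 Q) λ Y' → Lookupʳ ks' n (a , Y') × Y ⊑ Y'
  ⊑ᵏ-Lookupʳ (pointwise k) l = ⊑*-Lookupʳ k l
  ⊑ᵏ-Lookupʳ (new k) l with ⊑ᵏ-Lookupʳ k l
  ... | Y' , l' , g = Y' , later l' , g

  ⊑-SubAt : {Γ Γ' X : Seq 𝔄 Q} {p : List ℕ} → Γ ⊑ Γ' → SubAt Γ p X →
            Σ (Seq 𝔄 Q) λ X' → SubAt Γ' p X' × X ⊑ X'
  ⊑-SubAt g root = _ , root , g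
  ⊑-SubAt (node _ k) (child l s) with ⊑ᵏ-Lookupʳ k l
  ... | _ , l' , g with ⊑-SubAt g s
  ... | X' , s' , g' = X' , child l' s' , g'

  ⊑*-updAt : {ks : Children Q} {a : Letter 𝔄} {Y y : Seq 𝔄 Q} (m : (a , Y) ∈ ks) →
             Y ⊑ y → ks ⊑* updAt 𝔄 {Q} ks m (a , y)
  ⊑*-updAt (here refl) g = g ∷ ⊑*-refl
  ⊑*-updAt {Q = Q} (there m) g = ⊑-refl ∷ ⊑*-updAt {Q = Q} m g

  ⊑-replace : {Γ t : Seq 𝔄 Q} (π : Pos 𝔄 Γ) → subAt 𝔄 Γ π ⊑ t → Γ ⊑ replace 𝔄 Γ π t
  ⊑-replace here g = g
  ⊑-replace {Q = Q} {Γ = ⟦ _ , _ , _ ⟧} (down m π) g =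
    node (λ x → x) (pointwise (⊑*-updAt {Q = Q} m (⊑-replace π g)))

  ⊑-onKid : {X Y : Seq 𝔄 Q} {a : Letter 𝔄} (m : (a , Y) ∈ kids 𝔄 X) (f : Seq 𝔄 Q → Seq 𝔄 Q) →
            Y ⊑ f Y → X ⊑ onKid 𝔄 X m f
  ⊑-onKid {Q = Q} {X = ⟦ _ , _ , _ ⟧} m _ g = node (λ x → x) (pointwise (⊑*-updAt {Q = Q} m g))

  ⊑-addF : {X : Seq 𝔄 Q} {A : Fm 𝔄} → X ⊑ addF 𝔄 A X
  ⊑-addF {X = ⟦ _ , _ , _ ⟧} = node there (pointwise ⊑*-refl)

  ⊑-addF₂ : {X : Seq 𝔄 Q} {A B : Fm 𝔄} → X ⊑ addF 𝔄 A (addF 𝔄 B X)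
  ⊑-addF₂ {X = ⟦ _ , _ , _ ⟧} = node (λ x → there (there x)) (pointwise ⊑*-refl)

  ⊑-addL : {X : Seq 𝔄 Q} {s : Q} {A : Fm 𝔄} → X ⊑ addL 𝔄 s A X
  ⊑-addL {X = ⟦ _ , _ , _ ⟧} = node (λ x → x) (pointwise ⊑*-refl)

  ⊑-addK : {X Y : Seq 𝔄 Q} {a : Letter 𝔄} → X ⊑ addK 𝔄 a Y X
  ⊑-addK {X = ⟦ _ , _ , _ ⟧} = node (λ x → x) (new (pointwise ⊑*-refl))

  Labelled : Seq 𝔄 Q → List ℕ → Q × Fm 𝔄 → Set
  Labelled {Q} Γ q lab = Σ (Seq 𝔄 Q) λ X → SubAt Γ q X × lab ∈ labs 𝔄 X

  addL-∈ : (X : Seq 𝔄 Q) {s : Q} {A : Fm 𝔄} → (s , A) ∈ labs 𝔄 (addL 𝔄 s A X)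
  addL-∈ ⟦ _ , _ , _ ⟧ = here refl

  Labelled-addL : {Γ : Seq 𝔄 Q} (π : Pos 𝔄 Γ) {s : Q} {A : Fm 𝔄} →
                  Labelled (replace 𝔄 Γ π (addL 𝔄 s A (subAt 𝔄 Γ π))) (address π) (s , A)
  Labelled-addL {Γ = Γ} π = _ , SubAt-replace π , addL-∈ (subAt 𝔄 Γ π)

  AddsOnly : (List ℕ → Q × Fm 𝔄 → Set) → Seq 𝔄 Q → Seq 𝔄 Q → Set
  AddsOnly E Γ Γ' = ∀ {q lab} → Labelled Γ' q lab → Labelled Γ q lab ⊎ E q lab

  NoNewLabels : Seq 𝔄 Q → Seq 𝔄 Q → Set
  NoNewLabels = AddsOnly λ _ _ → ⊥

  Below : List ℕ → (List ℕ → Q × Fm 𝔄 → Set) → List ℕ → Q × Fm 𝔄 → Set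
  Below p E q lab = Σ (List ℕ) λ r → q ≡ p ++ r × E r lab

  AddsOnly-weaken : {E E' : List ℕ → Q × Fm 𝔄 → Set} {Γ Γ' : Seq 𝔄 Q} →
                    (∀ {q lab} → E q lab → E' q lab) → AddsOnly E Γ Γ' → AddsOnly E' Γ Γ'
  AddsOnly-weaken f h L with h L
  ... | inj₁ L' = inj₁ L'
  ... | inj₂ e  = inj₂ (f e)

  AddsOnly-replace : {E : List ℕ → Q × Fm 𝔄 → Set} {Γ t : Seq 𝔄 Q} (π : Pos 𝔄 Γ) →
                     AddsOnly E (subAt 𝔄 Γ π) t → AddsOnly (Below (address π) E) Γ (replace 𝔄 Γ π t)
  AddsOnly-replace here h L with h L
  ... | inj₁ L' = inj₁ L'
  ... | inj₂ e  = inj₂ (_ , refl , e)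
  AddsOnly-replace (down m π) h (_ , root , l) = inj₁ (_ , root , l)
  AddsOnly-replace {Q = Q} (down m π) h (X , child k s , l) with Lookupʳ-updAt⁻ {Q = Q} m k
  ... | inj₂ k' = inj₁ (X , child k' s , l)
  ... | inj₁ (refl , refl) with AddsOnly-replace π h (X , s , l)
  ...   | inj₁ (X' , s' , l') = inj₁ (X' , child (∈⇒Lookupʳ m) s' , l')
  ...   | inj₂ (r , refl , e) = inj₂ (r , refl , e)

  AddsOnly-onKid : {E : List ℕ → Q × Fm 𝔄 → Set} {X Y : Seq 𝔄 Q} {a : Letter 𝔄}
                   (m : (a , Y) ∈ kids 𝔄 X) (f : Seq 𝔄 Q → Seq 𝔄 Q) →
                   AddsOnly E Y (f Y) → AddsOnly (Below (indexʳ m ∷ []) E) X (onKid 𝔄 X m f)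
  AddsOnly-onKid {X = ⟦ _ , _ , _ ⟧} m f h (_ , root , l) = inj₁ (_ , root , l)
  AddsOnly-onKid {Q = Q} {X = ⟦ _ , _ , _ ⟧} m f h (Z , child k s , l) with Lookupʳ-updAt⁻ {Q = Q} m k
  ... | inj₂ k' = inj₁ (Z , child k' s , l)
  ... | inj₁ (refl , refl) with h (Z , s , l)
  ...   | inj₁ (Z' , s' , l') = inj₁ (Z' , child (∈⇒Lookupʳ m) s' , l')
  ...   | inj₂ e              = inj₂ (_ , refl , e)

  AddsOnly-addL : {X : Seq 𝔄 Q} {s : Q} {A : Fm 𝔄} →
                  AddsOnly (λ r lab → r ≡ [] × lab ≡ (s , A)) X (addL 𝔄 s A X)
  AddsOnly-addL {X = ⟦ _ , _ , _ ⟧} (_ , root , here e)  = inj₂ (refl , e)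
  AddsOnly-addL {X = ⟦ _ , _ , _ ⟧} (_ , root , there l) = inj₁ (_ , root , l)
  AddsOnly-addL {X = ⟦ _ , _ , _ ⟧} (Z , child k s , l)  = inj₁ (Z , child k s , l)

  NoNewLabels-addF : {X : Seq 𝔄 Q} {A : Fm 𝔄} → NoNewLabels X (addF 𝔄 A X)
  NoNewLabels-addF {X = ⟦ _ , _ , _ ⟧} (_ , root , l)      = inj₁ (_ , root , l)
  NoNewLabels-addF {X = ⟦ _ , _ , _ ⟧} (Z , child k s , l) = inj₁ (Z , child k s , l)

  NoNewLabels-addF₂ : {X : Seq 𝔄 Q} {A B : Fm 𝔄} → NoNewLabels X (addF 𝔄 A (addF 𝔄 B X))
  NoNewLabels-addF₂ {X = ⟦ _ , _ , _ ⟧} (_ , root , l)      = inj₁ (_ , root , l)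
  NoNewLabels-addF₂ {X = ⟦ _ , _ , _ ⟧} (Z , child k s , l) = inj₁ (Z , child k s , l)

  NoNewLabels-addK : {X : Seq 𝔄 Q} {a : Letter 𝔄} {A : Fm 𝔄} →
                     NoNewLabels X (addK 𝔄 a ⟦ A ∷ [] , [] , [] ⟧ X)
  NoNewLabels-addK {X = ⟦ _ , _ , _ ⟧} (_ , root , l)                = inj₁ (_ , root , l)
  NoNewLabels-addK {X = ⟦ _ , _ , _ ⟧} (_ , child now root , ())
  NoNewLabels-addK {X = ⟦ _ , _ , _ ⟧} (_ , child now (child () _) , _)
  NoNewLabels-addK {X = ⟦ _ , _ , _ ⟧} (Z , child (later k) s , l)   = inj₁ (Z , child k s , l)

  NoNewLabels-replace : {Γ t : Seq 𝔄 Q} (π : Pos 𝔄 Γ) → NoNewLabels (subAt 𝔄 Γ π) t →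
                        NoNewLabels Γ (replace 𝔄 Γ π t)
  NoNewLabels-replace π h = AddsOnly-weaken (λ { (_ , _ , ()) }) (AddsOnly-replace π h)

  NoNewLabels-onKid : {X Y : Seq 𝔄 Q} {a : Letter 𝔄} (m : (a , Y) ∈ kids 𝔄 X) (f : Seq 𝔄 Q → Seq 𝔄 Q) →
                      NoNewLabels Y (f Y) → NoNewLabels X (onKid 𝔄 X m f)
  NoNewLabels-onKid m f h = AddsOnly-weaken (λ { (_ , _ , ()) }) (AddsOnly-onKid m f h)

  module Translation {Q₁ Q₂ : Set} {E₁ : Seq 𝔄 Q₁ → Seq 𝔄 Q₁ → Set} {E₂ : Seq 𝔄 Q₂ → Seq 𝔄 Q₂ → Set}
    (Inv : Seq 𝔄 Q₁ → Set)
    (Inv-grow : ∀ {Γ Γ'} → Inv Γ → Γ ⊑ Γ' → NoNewLabels Γ Γ' → Inv Γ')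
    (simulate : ∀ {Γ₁ Γ₁' Γ₂} → E₁ Γ₁ Γ₁' → Inv Γ₁ → Γ₁ ≅ Γ₂ →
                Inv Γ₁' × ((∀ {Γ₂'} → Γ₁' ≅ Γ₂' → Der 𝔄 E₂ Γ₂') → Der 𝔄 E₂ Γ₂))
    where

    premise : {Γ₁ t₁ : Seq 𝔄 Q₁} {Γ₂ t₂ : Seq 𝔄 Q₂} → Inv Γ₁ → (R : Γ₁ ≅ Γ₂) (π : Pos 𝔄 Γ₁) →
              subAt 𝔄 Γ₁ π ⊑ t₁ → NoNewLabels (subAt 𝔄 Γ₁ π) t₁ → t₁ ≅ t₂ →
              Inv (replace 𝔄 Γ₁ π t₁) × replace 𝔄 Γ₁ π t₁ ≅ replace 𝔄 Γ₂ (transport R π) t₂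
    premise inv R π g h T =
      Inv-grow inv (⊑-replace π g) (NoNewLabels-replace π h) , ≅-replace-transport R π T

    translate : {Γ₁ : Seq 𝔄 Q₁} {Γ₂ : Seq 𝔄 Q₂} → Der 𝔄 E₁ Γ₁ → Inv Γ₁ × Γ₁ ≅ Γ₂ → Der 𝔄 E₂ Γ₂
    translate (idd π p∈ ¬p∈) (_ , R) = idd (transport R π) (≅-∈fms S p∈) (≅-∈fms S ¬p∈)
      where S = ≅-subAt-transport R π
    translate (∧d π m d₁ d₂) (inv , R) =
      ∧d (transport R π) (≅-∈fms S m)
         (translate d₁ (premise inv R π ⊑-addF NoNewLabels-addF (≅-addF S)))
         (translate d₂ (premise inv R π ⊑-addF NoNewLabels-addF (≅-addF S)))
      where S = ≅-subAt-transport R π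
    translate (∨d π m d) (inv , R) =
      ∨d (transport R π) (≅-∈fms S m)
         (translate d (premise inv R π ⊑-addF₂ NoNewLabels-addF₂ (≅-addF (≅-addF S))))
      where S = ≅-subAt-transport R π
    translate (boxd π m d) (inv , R) =
      boxd (transport R π) (≅-∈fms S m)
           (translate d (premise inv R π ⊑-addK NoNewLabels-addK (≅-addK S (node []))))
      where S = ≅-subAt-transport R π
    translate (dia↑ π {A = A} m k d) (inv , R) =
      let S = ≅-subAt-transport R π
          _ , k₂ , e , _ = ≅*-∈ (≅-kids S) k
      in dia↑ (transport R π) (≅-∈fms S m) k₂
           (translate d (premise inv R π (⊑-onKid k (addF 𝔄 A) ⊑-addF)
                                        (NoNewLabels-onKid k (addF 𝔄 A) NoNewLabels-addF)
                                        (≅-onKid S k k₂ (sym e) (addF 𝔄 A) (addF 𝔄 A) ≅-addF)))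
    translate (dia↓ π k m d) (inv , R) =
      let S = ≅-subAt-transport R π
          _ , k₂ , _ , SY = ≅*-∈ (≅-kids S) k
      in dia↓ (transport R π) k₂ (≅-∈fms SY m)
           (translate d (premise inv R π ⊑-addF NoNewLabels-addF (≅-addF S)))
    translate (extra r d) (inv , R) with simulate r inv R
    ... | inv' , continue = continue λ R' → translate d (inv' , R')

  module _ (S : Rules 𝔄) (𝒜 : FSA 𝔄) (r : Represents 𝔄 S 𝒜) where
    open FSA 𝒜 using (nQ; δ)
    open Represents r using (init; correct)

    private
      DKmS : Seq 𝔄 ⊥ → Set
      DKmS = Der 𝔄 (RuleS 𝔄 S)

      DKmA : Seq 𝔄 (Fin nQ) → Set
      DKmA = Der 𝔄 (RuleA 𝔄 𝒜 init)

    -- The label s : A travels along the walk by t↑ / t↓, following a run of 𝒜 on the word read.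
    propagate : {Γ₁ : Seq 𝔄 ⊥} {A : Fm 𝔄} (j : Pos 𝔄 Γ₁) {p : List ℕ} {w : List (Letter 𝔄)}
                {s : Fin nQ} →
                AddrWalk Γ₁ p w (address j) → AcceptsFrom 𝔄 𝒜 s w →
                (∀ {Γ'} → replace 𝔄 Γ₁ j (addF 𝔄 A (subAt 𝔄 Γ₁ j)) ≅ Γ' → DKmA Γ') →
                {Γ : Seq 𝔄 (Fin nQ)} → Γ₁ ≅ Γ → Labelled Γ p (s , A) → DKmA Γ
    propagate j stay (done fin) K R (_ , at , l) with SubAt⇒Pos at
    ... | π , e , refl =
      extra (fR π l fin) (K (≅-replace R j π (sym e) (≅-addF (≅-subAt R j π (sym e)))))
    propagate {A = A} j (descend at₁ l₁ rest) (move {q' = s'} δe acc) K R (_ , at , l)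
      with ≅-SubAt R at₁
    ... | _ , at₂ , SX with SubAt-functional at₂ at
    ... | refl with SubAt⇒Pos at
    ... | π , refl , refl with ≅*-Lookupʳ (≅-kids SX) l₁
    ... | Y , l₂ , _ with Lookupʳ⇒∈ l₂
    ... | m , refl =
      extra (t↑ π l m δe)
        (propagate j rest acc K (≅-trans R (≅-replaceʳ π (≅-onKidʳ m (addL 𝔄 s' A) ≅-addL)))
           (_ , SubAt-++ (SubAt-replace π) (SubAt-onKid m) , addL-∈ Y))
    propagate j (ascend at₁ l₁ rest) (move δe acc) K R (_ , at , l)
      with ≅-SubAt R at₁
    ... | _ , at₂ , SX with SubAt⇒Pos at₂
    ... | π , refl , refl with ≅*-Lookupʳ (≅-kids SX) l₁
    ... | _ , l₂ , _ with Lookupʳ⇒∈ l₂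
    ... | m , refl with SubAt-functional (SubAt-∷ʳ (SubAt-address π) (∈⇒Lookupʳ m)) at
    ... | refl =
      extra (t↓ π m l δe)
        (propagate j rest acc K (≅-trans R (≅-replaceʳ π ≅-addL)) (Labelled-addL π))

    simulate-pS : {Γ₁ Γ₁' : Seq 𝔄 ⊥} {Γ₂ : Seq 𝔄 (Fin nQ)} → RuleS 𝔄 S Γ₁ Γ₁' → ⊤ → Γ₁ ≅ Γ₂ →
                  ⊤ × ((∀ {Γ₂'} → Γ₁' ≅ Γ₂' → DKmA Γ₂') → DKmA Γ₂)
    simulate-pS {Γ₁} (pS i j {a} dm w walk w∈L) _ R = tt , λ K →
      extra (iR π (≅-∈fms (≅-subAt-transport R i) dm))
        (propagate j walk′ (proj₁ (correct a w) w∈L) K (≅-trans R (≅-replaceʳ π ≅-addL)) (Labelled-addL π))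
      where
        π = transport R i
        walk′ = subst (λ p → AddrWalk Γ₁ p w (address j)) (address-transport R i) (Walk⇒AddrWalk walk)

    ProvableS⇒ProvableA : {A : Fm 𝔄} → ProvableS 𝔄 S A → ProvableA 𝔄 𝒜 init A
    ProvableS⇒ProvableA d = Translation.translate (λ _ → ⊤) (λ _ _ _ → tt) simulate-pS d (tt , node [])

    data Justified (Γ : Seq 𝔄 (Fin nQ)) : List ℕ → Fin nQ → Fm 𝔄 → Set where
      start   : ∀ {p X a B} → SubAt Γ p X → dia a B ∈ fms 𝔄 X → Justified Γ p (init a) B
      descend : ∀ {p X n a Y s s' B} → Justified Γ p s B → SubAt Γ p X → Lookupʳ (kids 𝔄 X) n (a , Y) →
                δ s a s' ≡ true → Justified Γ (p ∷ʳ n) s' B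
      ascend  : ∀ {p X n a Y s s' B} → Justified Γ (p ∷ʳ n) s B → SubAt Γ p X →
                Lookupʳ (kids 𝔄 X) n (a , Y) → δ s (bar a) s' ≡ true → Justified Γ p s' B

    Justified-⊑ : {Γ Γ' : Seq 𝔄 (Fin nQ)} {q : List ℕ} {s : Fin nQ} {B : Fm 𝔄} →
                  Γ ⊑ Γ' → Justified Γ q s B → Justified Γ' q s B
    Justified-⊑ g (start at dm) with ⊑-SubAt g at
    ... | _ , at' , g' = start at' (⊑-fms g' dm)
    Justified-⊑ g (descend J at l δe) with ⊑-SubAt g at
    ... | _ , at' , g' = descend (Justified-⊑ g J) at' (proj₁ (proj₂ (⊑ᵏ-Lookupʳ (⊑-kids g') l))) δe
    Justified-⊑ g (ascend J at l δe) with ⊑-SubAt g at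
    ... | _ , at' , g' = ascend (Justified-⊑ g J) at' (proj₁ (proj₂ (⊑ᵏ-Lookupʳ (⊑-kids g') l))) δe

    record Propagation {Q : Set} (Γ : Seq 𝔄 Q) (B : Fm 𝔄) (target : List ℕ) : Set where
      constructor propagation
      field
        {source}  : List ℕ
        {letter}  : Letter 𝔄
        {word}    : List (Letter 𝔄)
        {origin}  : Seq 𝔄 Q
        source-at : SubAt Γ source origin
        dia∈      : dia letter B ∈ fms 𝔄 origin
        walk      : AddrWalk Γ source word target
        accepted  : AcceptsFrom 𝔄 𝒜 (init letter) word

    unwind : {Γ : Seq 𝔄 (Fin nQ)} {q r : List ℕ} {s : Fin nQ} {B : Fm 𝔄} {w : List (Letter 𝔄)} →
             Justified Γ q s B → AddrWalk Γ q w r → AcceptsFrom 𝔄 𝒜 s w → Propagation Γ B r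
    unwind (start at dm)        wp acc = propagation at dm wp acc
    unwind (descend J at l δe) wp acc = unwind J (descend at l wp) (move δe acc)
    unwind (ascend J at l δe)  wp acc = unwind J (ascend at l wp) (move δe acc)

    Propagation⇒DKmS : {Γ : Seq 𝔄 Q} {Γ₂ : Seq 𝔄 ⊥} {B : Fm 𝔄} → Γ ≅ Γ₂ → (π : Pos 𝔄 Γ) →
                       Propagation Γ B (address π) →
                       (∀ {Γ₂'} → replace 𝔄 Γ π (addF 𝔄 B (subAt 𝔄 Γ π)) ≅ Γ₂' → DKmS Γ₂') → DKmS Γ₂
    Propagation⇒DKmS R π (propagation {letter = a} {word = w} at dm wp acc) K with ≅-SubAt R at
    ... | _ , at₂ , SX with SubAt⇒Pos at₂
    ... | i , ai , refl with AddrWalk⇒Walk (≅-AddrWalk R wp) i ai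
    ... | j , aj , walk =
      extra (pS i j (≅-∈fms SX dm) w walk (proj₂ (correct a w) acc))
            (K (≅-replace R π j (sym aj) (≅-addF (≅-subAt R π j (sym aj)))))

    Inv : Seq 𝔄 (Fin nQ) → Set
    Inv Γ = ∀ {q s B} → Labelled Γ q (s , B) → Justified Γ q s B

    Inv-extend : {E : List ℕ → Fin nQ × Fm 𝔄 → Set} {Γ Γ' : Seq 𝔄 (Fin nQ)} → Inv Γ → Γ ⊑ Γ' →
                 AddsOnly E Γ Γ' → (∀ {q s B} → E q (s , B) → Justified Γ' q s B) → Inv Γ'
    Inv-extend inv g h justify L with h L
    ... | inj₁ L' = Justified-⊑ g (inv L')
    ... | inj₂ e  = justify e

    Inv-grow : {Γ Γ' : Seq 𝔄 (Fin nQ)} → Inv Γ → Γ ⊑ Γ' → NoNewLabels Γ Γ' → Inv Γ'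
    Inv-grow inv g h = Inv-extend inv g h λ ()

    Inv-initial : {A : Fm 𝔄} → Inv ⟦ A ∷ [] , [] , [] ⟧
    Inv-initial (_ , root , ())
    Inv-initial (_ , child () _ , _)

    skip-labelling : {Γ Γ' : Seq 𝔄 (Fin nQ)} {Γ₂ : Seq 𝔄 ⊥} → Γ ≅ Γ' → Γ ≅ Γ₂ →
                 (∀ {Γ₂'} → Γ' ≅ Γ₂' → DKmS Γ₂') → DKmS Γ₂
    skip-labelling E R K = K (≅-trans (≅-sym E) R)

    simulate-RA : {Γ Γ' : Seq 𝔄 (Fin nQ)} {Γ₂ : Seq 𝔄 ⊥} → RuleA 𝔄 𝒜 init Γ Γ' → Inv Γ → Γ ≅ Γ₂ →
                  Inv Γ' × ((∀ {Γ₂'} → Γ' ≅ Γ₂' → DKmS Γ₂') → DKmS Γ₂)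
    simulate-RA {Γ} {Γ'} (iR π {a} {A} dm) inv R =
      Inv-extend inv G (AddsOnly-replace π AddsOnly-addL) justify , skip-labelling (≅-replaceʳ π ≅-addL) R
      where
        G = ⊑-replace π ⊑-addL
        justify : ∀ {q s B} → Below (address π) (λ r lab → r ≡ [] × lab ≡ (init a , A)) q (s , B) →
                  Justified Γ' q s B
        justify (_ , refl , refl , refl) with ⊑-SubAt G (SubAt-address π)
        ... | _ , at , g = subst (λ q → Justified Γ' q (init a) A) (sym (++-identityʳ (address π)))
                                 (start at (⊑-fms g dm))
    simulate-RA {Γ} {Γ'} (t↑ π {s} {s'} {a} {A} l m δe) inv R =
      Inv-extend inv G (AddsOnly-replace π (AddsOnly-onKid m (addL 𝔄 s' A) AddsOnly-addL)) justify ,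
      skip-labelling (≅-replaceʳ π (≅-onKidʳ m (addL 𝔄 s' A) ≅-addL)) R
      where
        G = ⊑-replace π (⊑-onKid m (addL 𝔄 s' A) ⊑-addL)
        justify : ∀ {q s B} →
                  Below (address π) (Below (indexʳ m ∷ []) λ r lab → r ≡ [] × lab ≡ (s' , A)) q (s , B) →
                  Justified Γ' q s B
        justify (_ , refl , _ , refl , refl , refl) with ⊑-SubAt G (SubAt-address π)
        ... | _ , at , g = descend (Justified-⊑ G (inv (_ , SubAt-address π , l))) at
                                   (proj₁ (proj₂ (⊑ᵏ-Lookupʳ (⊑-kids g) (∈⇒Lookupʳ m)))) δe
    simulate-RA {Γ} {Γ'} (t↓ π {s} {s'} {a} {A} m l δe) inv R =
      Inv-extend inv G (AddsOnly-replace π AddsOnly-addL) justify , skip-labelling (≅-replaceʳ π ≅-addL) R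
      where
        G = ⊑-replace π ⊑-addL
        justify : ∀ {q s B} → Below (address π) (λ r lab → r ≡ [] × lab ≡ (s' , A)) q (s , B) →
                  Justified Γ' q s B
        justify (_ , refl , refl , refl) with ⊑-SubAt G (SubAt-address π)
        ... | _ , at , g =
          subst (λ q → Justified Γ' q s' A) (sym (++-identityʳ (address π)))
            (ascend (Justified-⊑ G (inv (_ , SubAt-∷ʳ (SubAt-address π) (∈⇒Lookupʳ m) , l))) at
                    (proj₁ (proj₂ (⊑ᵏ-Lookupʳ (⊑-kids g) (∈⇒Lookupʳ m)))) δe)
    simulate-RA (fR π l fin) inv R =
      Inv-grow inv (⊑-replace π ⊑-addF) (NoNewLabels-replace π NoNewLabels-addF) ,
      Propagation⇒DKmS R π (unwind (inv (_ , SubAt-address π , l)) stay (done fin))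

    ProvableA⇒ProvableS : {A : Fm 𝔄} → ProvableA 𝔄 𝒜 init A → ProvableS 𝔄 S A
    ProvableA⇒ProvableS d = Translation.translate Inv Inv-grow simulate-RA d (Inv-initial , node [])

-- Closedness and regularity only guarantee that a representing 𝒜 exists; the proof needs
-- nothing beyond Represents.
theorem5p2 : (𝔄 : Alph) (S : Rules 𝔄) → Closed 𝔄 S → Regular 𝔄 S →
             (𝒜 : FSA 𝔄) (r : Represents 𝔄 S 𝒜) (A : Fm 𝔄) →
             (ProvableS 𝔄 S A → ProvableA 𝔄 𝒜 (Represents.init r) A)
             × (ProvableA 𝔄 𝒜 (Represents.init r) A → ProvableS 𝔄 S A)
theorem5p2 𝔄 S _ _ 𝒜 r A = ProvableS⇒ProvableA 𝔄 S 𝒜 r , ProvableA⇒ProvableS 𝔄 S 𝒜 r
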